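{- For all integers $d \geq 1$ and $h \geq 1$, the double-tree of degree $d$ and height $h$ has a Hamiltonian path from the root of its upper tree to the root of its lower tree.
   Context: The double-tree of degree $d$ and height $h$ is the following graph. Take two disjoint complete rooted $d$-ary trees of height $h$ (every inner vertex has exactly $d$ children and all leaves are at depth $h$), called the upper and the lower tree, each drawn in the plane with children ordered left to right. Let $l = d^{h-1}$ be the number of parents of leaves in each tree. Name the leaves of the upper tree from left to right $u_1^1,\ldots,u_d^1,u_1^2,\ldots,u_d^2,\ldots,u_1^l,\ldots,u_d^l$ (so $u_1^j,\ldots,u_d^j$ are the children of the $j$-th parent of leaves), and likewise the leaves of the lower tree $v_1^1,\ldots,v_d^l$. Besides the tree edges, add $E_1 = \{u_i^j u_{i+1}^j, \ v_i^j v_{i+1}^j : 1\le i\le d-1,\ 1\le j\le l\} \cup \{u_d^j u_1^{j+1},\ v_d^j v_1^{j+1} : 1\le j\le l-1\}$ and $E_2 = \{u_n^j v_m^j : 1\le j\le l,\ n\le m\} \cup \{u_n^j v_m^{j+1} : 1\le j\le l-1,\ m<n\} \cup \{u_n^l v_m^1 : m<n\}$, where $1\le n,m\le d$. -}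

module Defs where

open import Data.Nat using (ℕ; zero; suc; _+_; _*_; _∸_; _^_; _≤_; _<_)
open import Data.Fin using (Fin; toℕ)
open import Data.List using (List; []; _∷_; length; head; last)
open import Data.Product using (Σ; _×_; _,_; ∃)
open import Data.Sum using (_⊎_)
open import Data.Maybe using (just)
open import Relation.Binary.PropositionalEquality using (_≡_)
open import Data.List.Relation.Unary.Linked using (Linked)
open import Data.List.Relation.Unary.Unique.Propositional using (Unique)
open import Data.List.Membership.Propositional using (_∈_)

-- The two copies of the complete d-ary tree.
data Side : Set where
  upper lower : Side

-- A vertex of a complete d-ary tree of height h is its address: the list
-- of child choices on the path from the root, stored DEEPEST FIRST
-- (so the children of the vertex with address p are c ∷ p, c : Fin d,
-- where Fin d = {0,…,d-1} encodes the left-to-right order of children).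
-- Addresses have length ≤ h; leaves are the addresses of length exactly h.
TreeVertex : ℕ → ℕ → Set
TreeVertex d h = Σ (List (Fin d)) (λ a → length a ≤ h)

DTVertex : ℕ → ℕ → Set
DTVertex d h = Side × TreeVertex d h

-- Value of an address read as a base-d numeral (most significant digit =
-- the child choice closest to the root, i.e. the last list element).
-- For a leaf c ∷ r, val r is the 0-based index j-1 of its parent among the
-- l = d^(h-1) parents of leaves (left to right), and toℕ c is the 0-based
-- index i-1 of the leaf among its siblings.
val : ∀ {d} → List (Fin d) → ℕ
val {d} []      = 0
val {d} (c ∷ r) = toℕ c + d * val r

-- Edges of the double tree of degree d and height h, on addresses
-- (one orientation; adjacency is the symmetric closure below).
data Edge (d h : ℕ) : Side → List (Fin d) → Side → List (Fin d) → Set where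
  tree   : ∀ s p (c : Fin d) → Edge d h s p s (c ∷ p)
  -- E1: consecutive leaves (left to right) in the same tree:
  -- u_i^j u_{i+1}^j and u_d^j u_1^{j+1} (same for v)
  leafE1 : ∀ s (c c' : Fin d) r r' →
           length (c ∷ r) ≡ h → length (c' ∷ r') ≡ h →
           val (c ∷ r) + 1 ≡ val (c' ∷ r') →
           Edge d h s (c ∷ r) s (c' ∷ r')
  -- E2: u_n^j v_m^j with n ≤ m
  cross1 : ∀ (c c' : Fin d) r r' →
           length (c ∷ r) ≡ h → length (c' ∷ r') ≡ h →
           val r' ≡ val r → toℕ c ≤ toℕ c' →
           Edge d h upper (c ∷ r) lower (c' ∷ r')
  -- E2: u_n^j v_m^{j+1} with m < n
  cross2 : ∀ (c c' : Fin d) r r' →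
           length (c ∷ r) ≡ h → length (c' ∷ r') ≡ h →
           val r' ≡ suc (val r) → toℕ c' < toℕ c →
           Edge d h upper (c ∷ r) lower (c' ∷ r')
  -- E2: u_n^l v_m^1 with m < n   (l = d^(h-1))
  cross3 : ∀ (c c' : Fin d) r r' →
           length (c ∷ r) ≡ h → length (c' ∷ r') ≡ h →
           val r ≡ d ^ (h ∸ 1) ∸ 1 → val r' ≡ 0 → toℕ c' < toℕ c →
           Edge d h upper (c ∷ r) lower (c' ∷ r')

Adj : ∀ d h → DTVertex d h → DTVertex d h → Set
Adj d h (s , a , _) (t , b , _) = Edge d h s a t b ⊎ Edge d h t b s a

rootU rootL : ∀ {d h} → DTVertex d h
rootU = upper , [] , Data.Nat.z≤n
rootL = lower , [] , Data.Nat.z≤n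

HamiltonianPath : ∀ d h → DTVertex d h → DTVertex d h → Set
HamiltonianPath d h x y =
  ∃ λ (P : List (DTVertex d h)) →
    Linked (Adj d h) P × Unique P × (∀ v → v ∈ P) ×
    head P ≡ just x × last P ≡ just y

module Submission where

-- Only two of the extra edges are needed:
-- the path first visits the whole upper tree, from its root to its rightmost
-- leaf, crosses by one E2 edge to the leftmost leaf of the lower tree, and
-- then visits the whole lower tree, ending at its root.  Inside a single
-- tree (tree edges plus the E1 edges between consecutive leaves) we build,
-- by simultaneous recursion on the height, three Hamiltonian paths:
--   rootToRight : root → rightmost leaf,
--   leftToRoot  : leftmost leaf → root,
--   leftToRight : leftmost leaf → rightmost leaf   (only when d ≥ 2).
-- Each is made of the root together with one such path inside each of the d
-- subtrees of the root; consecutive subtrees are joined by the E1 edge from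
-- the rightmost leaf of one to the leftmost leaf of the next.

open import Defs
open import Data.Nat using (ℕ; zero; suc; _+_; _*_; _∸_; _^_; _≤_; z≤n; s≤s; s≤s⁻¹)
open import Data.Nat.Properties using (≤-irrelevant; ≤-reflexive; m+n∸n≡m; +-comm; *-zeroʳ; *-suc)
open import Data.Nat.Tactic.RingSolver using (solve-∀)
open import Data.Fin using (Fin; toℕ; fromℕ; inject₁) renaming (zero to fz; suc to fs)
open import Data.Fin.Properties using (toℕ-fromℕ)
open import Data.List
  using (List; []; _∷_; length; _++_; _∷ʳ_; map; head; last; replicate; tabulate; allFin; InitLast; initLast; _∷ʳ′_)
open import Data.List.Properties
  using (length-++; length-replicate; ++-assoc; ++-identityʳ; ∷ʳ-injective; map-tabulate; map-++)
open import Data.Product using (_×_; _,_; ∃₂; proj₁; proj₂)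
open import Data.Sum using (_⊎_; inj₁; inj₂)
open import Data.Maybe using (just)
open import Function using (_∘_)
open import Relation.Binary.PropositionalEquality
  using (_≡_; _≢_; refl; sym; trans; cong; cong₂; subst; subst₂; module ≡-Reasoning)
open import Data.List.Relation.Unary.All as All using (All; []; _∷_)
import Data.List.Relation.Unary.All.Properties as All
open import Data.List.Relation.Unary.Any using (here; there)
open import Data.List.Relation.Unary.Linked using (Linked; [-]; _∷_)
open import Data.List.Relation.Unary.Unique.Propositional using (Unique)
open import Data.List.Relation.Unary.AllPairs using ([]; _∷_)
open import Data.List.Relation.Binary.Disjoint.Propositional using (Disjoint)
import Data.List.Relation.Unary.Unique.Propositional.Properties as Unique
open import Data.List.Membership.Propositional using (_∈_)
open import Data.List.Membership.Propositional.Properties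
  using (∈-++⁺ˡ; ∈-++⁺ʳ; ∈-++⁻; ∈-map⁺; ∈-map⁻; ∈-allFin)
open import Data.List.Relation.Binary.Permutation.Propositional using (_↭_; ↭-sym; ↭⇒↭ₛ; module PermutationReasoning)
open import Data.List.Relation.Binary.Permutation.Propositional.Properties using (All-resp-↭; ∈-resp-↭; shift)
import Data.List.Relation.Binary.Permutation.Setoid.Properties as SetoidPermutation
open import Relation.Binary.PropositionalEquality.Properties using (setoid)

-- Addresses in the tree of degree suc e (Defs: child choices, deepest first).
-- Appending c at the END of an address moves it into the subtree of the
-- root's child c.
Addr : ℕ → Set
Addr e = List (Fin (suc e))

leftLeaf : ∀ {e} → ℕ → Addr e
leftLeaf k = replicate k fz

rightLeaf : ∀ e → ℕ → Addr e
rightLeaf e k = replicate k (fromℕ e)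

-- The leftmost/rightmost leaf of height suc k lies in the leftmost/rightmost
-- subtree of the root, at the leftmost/rightmost leaf of that subtree.
replicate-∷ʳ : ∀ {A : Set} k (x : A) → replicate k x ∷ʳ x ≡ replicate (suc k) x
replicate-∷ʳ zero    x = refl
replicate-∷ʳ (suc k) x = cong (x ∷_) (replicate-∷ʳ k x)

length-∷ʳ : ∀ {A : Set} (q : List A) x → length (q ∷ʳ x) ≡ suc (length q)
length-∷ʳ q x = trans (length-++ q) (+-comm (length q) 1)

data TreeStep {e} (k : ℕ) : Addr e → Addr e → Set where
  toChild    : ∀ p c → TreeStep k p (c ∷ p)
  toNextLeaf : ∀ {a b} → length a ≡ k → length b ≡ k → val a + 1 ≡ val b → TreeStep k a b

TreeAdj : ∀ {e} → ℕ → Addr e → Addr e → Set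
TreeAdj k a b = TreeStep k a b ⊎ TreeStep k b a

val-∷ʳ : ∀ {e} (q : Addr e) c → val (q ∷ʳ c) ≡ val q + suc e ^ length q * toℕ c
val-∷ʳ {e} []      c = cong (toℕ c +_) (*-zeroʳ (suc e))
val-∷ʳ {e} (x ∷ q) c = begin
  toℕ x + suc e * val (q ∷ʳ c)                              ≡⟨ cong (λ v → toℕ x + suc e * v) (val-∷ʳ q c) ⟩
  toℕ x + suc e * (val q + suc e ^ length q * toℕ c)         ≡⟨ distribute (toℕ x) (suc e) (val q) (suc e ^ length q) (toℕ c) ⟩
  (toℕ x + suc e * val q) + suc e * suc e ^ length q * toℕ c ∎
  where
  open ≡-Reasoning
  distribute : ∀ x d v D c → x + d * (v + D * c) ≡ (x + d * v) + d * D * c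
  distribute = solve-∀

val-leftLeaf : ∀ {e} k → val (leftLeaf {e} k) ≡ 0
val-leftLeaf zero    = refl
val-leftLeaf {e} (suc k) = trans (cong (suc e *_) (val-leftLeaf k)) (*-zeroʳ (suc e))

val-rightLeaf : ∀ e k → val (rightLeaf e k) + 1 ≡ suc e ^ k
val-rightLeaf e zero    = refl
val-rightLeaf e (suc k) = begin
  (toℕ (fromℕ e) + suc e * val (rightLeaf e k)) + 1
                                                   ≡⟨ cong (λ t → (t + suc e * val (rightLeaf e k)) + 1) (toℕ-fromℕ e) ⟩
  (e + suc e * val (rightLeaf e k)) + 1            ≡⟨ factor e (val (rightLeaf e k)) ⟩
  suc e * (val (rightLeaf e k) + 1)                ≡⟨ cong (suc e *_) (val-rightLeaf e k) ⟩
  suc e * suc e ^ k                                ∎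
  where
  open ≡-Reasoning
  factor : ∀ e v → (e + suc e * v) + 1 ≡ suc e * (v + 1)
  factor = solve-∀

val-∷ʳ-depth : ∀ {e k} (q : Addr e) c → length q ≡ k → val (q ∷ʳ c) ≡ val q + suc e ^ k * toℕ c
val-∷ʳ-depth q c refl = val-∷ʳ q c

carry : ∀ v w → (v + w) + 1 ≡ (v + 1) + w
carry = solve-∀

step-∷ʳ : ∀ {e k} {a b : Addr e} c → TreeStep k a b → TreeStep (suc k) (a ∷ʳ c) (b ∷ʳ c)
step-∷ʳ c (toChild p c') = toChild (p ∷ʳ c) c'
step-∷ʳ {e} {k} {a} {b} c (toNextLeaf la lb next) =
  toNextLeaf (trans (length-∷ʳ a c) (cong suc la)) (trans (length-∷ʳ b c) (cong suc lb)) (begin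
    val (a ∷ʳ c) + 1                  ≡⟨ cong (_+ 1) (val-∷ʳ-depth a c la) ⟩
    (val a + suc e ^ k * toℕ c) + 1   ≡⟨ carry (val a) _ ⟩
    (val a + 1) + suc e ^ k * toℕ c   ≡⟨ cong (_+ suc e ^ k * toℕ c) next ⟩
    val b + suc e ^ k * toℕ c         ≡⟨ sym (val-∷ʳ-depth b c lb) ⟩
    val (b ∷ʳ c)                      ∎)
  where open ≡-Reasoning

adj-∷ʳ : ∀ {e k} {a b : Addr e} c → TreeAdj k a b → TreeAdj (suc k) (a ∷ʳ c) (b ∷ʳ c)
adj-∷ʳ c (inj₁ s) = inj₁ (step-∷ʳ c s)
adj-∷ʳ c (inj₂ s) = inj₂ (step-∷ʳ c s)

junction : ∀ {e} k {c c' : Fin (suc e)} → toℕ c' ≡ suc (toℕ c) →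
           TreeAdj (suc k) (rightLeaf e k ∷ʳ c) (leftLeaf k ∷ʳ c')
junction {e} k {c} {c'} c'≡c+1 = inj₁ (toNextLeaf
  (trans (length-∷ʳ (rightLeaf e k) c) (cong suc (length-replicate k)))
  (trans (length-∷ʳ (leftLeaf k) c') (cong suc (length-replicate k)))
  (begin
    val (rightLeaf e k ∷ʳ c) + 1         ≡⟨ cong (_+ 1) (val-∷ʳ-depth (rightLeaf e k) c (length-replicate k)) ⟩
    (val (rightLeaf e k) + D * toℕ c) + 1 ≡⟨ carry (val (rightLeaf e k)) _ ⟩
    (val (rightLeaf e k) + 1) + D * toℕ c ≡⟨ cong (_+ D * toℕ c) (val-rightLeaf e k) ⟩
    D + D * toℕ c                        ≡⟨ sym (*-suc D (toℕ c)) ⟩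
    D * suc (toℕ c)                      ≡⟨ cong (D *_) (sym c'≡c+1) ⟩
    D * toℕ c'                           ≡⟨ cong (_+ D * toℕ c') (sym (val-leftLeaf k)) ⟩
    val (leftLeaf {e} k) + D * toℕ c'     ≡⟨ sym (val-∷ʳ-depth (leftLeaf k) c' (length-replicate k)) ⟩
    val (leftLeaf k ∷ʳ c')               ∎))
  where
  open ≡-Reasoning
  D : ℕ
  D = suc e ^ k

data Walk {A : Set} (R : A → A → Set) : A → A → List A → Set where
  done : ∀ x → Walk R x x (x ∷ [])
  _◅_  : ∀ {x y z xs} → R x y → Walk R y z xs → Walk R x z (x ∷ xs)
infixr 5 _◅_

join : ∀ {A R} {x y z w : A} {xs ys} → Walk R x y xs → R y z → Walk R z w ys → Walk R x w (xs ++ ys)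
join (done _)  r w₂ = r ◅ w₂
join (r' ◅ w₁) r w₂ = r' ◅ join w₁ r w₂

mapWalk : ∀ {A B : Set} {R : A → A → Set} {S : B → B → Set} (f : A → B) →
          (∀ {a b} → R a b → S (f a) (f b)) → ∀ {x y xs} → Walk R x y xs → Walk S (f x) (f y) (map f xs)
mapWalk f g (done _) = done _
mapWalk f g (r ◅ w)  = g r ◅ mapWalk f g w

walk-linked : ∀ {A R} {x y : A} {xs} → Walk R x y xs → Linked R xs
walk-linked (done _)         = [-]
walk-linked (r ◅ done _)     = r ∷ [-]
walk-linked (r ◅ w@(_ ◅ _))  = r ∷ walk-linked w

walk-head : ∀ {A R} {x y : A} {xs} → Walk R x y xs → head xs ≡ just x
walk-head (done _) = refl
walk-head (_ ◅ _)  = refl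

walk-last : ∀ {A R} {x y : A} {xs} → Walk R x y xs → last xs ≡ just y
walk-last (done _)        = refl
walk-last (_ ◅ done _)    = refl
walk-last (_ ◅ w@(_ ◅ _)) = walk-last w

inSubtree : ∀ {e} → Fin (suc e) → List (Addr e) → List (Addr e)
inSubtree c = map (_∷ʳ c)

walkInSubtree : ∀ {e k} {x y : Addr e} {xs} c → Walk (TreeAdj k) x y xs →
                Walk (TreeAdj (suc k)) (x ∷ʳ c) (y ∷ʳ c) (inSubtree c xs)
walkInSubtree c = mapWalk (_∷ʳ c) (adj-∷ʳ c)

Block : ℕ → Set
Block e = Fin (suc e) × List (Addr e)

glue : ∀ {e} → List (Block e) → List (Addr e)
glue []              = []
glue ((c , xs) ∷ bs) = inSubtree c xs ++ glue bs

glue-++ : ∀ {e} (bs bs' : List (Block e)) → glue (bs ++ bs') ≡ glue bs ++ glue bs'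
glue-++ []              bs' = refl
glue-++ ((c , xs) ∷ bs) bs' = trans (cong (inSubtree c xs ++_) (glue-++ bs bs')) (sym (++-assoc (inSubtree c xs) _ _))

sweep : ∀ {e} → List (Addr e) → List (Fin (suc e)) → List (Block e)
sweep xs = map (_, xs)

children-sweep : ∀ {e} (xs : List (Addr e)) cs → map proj₁ (sweep xs cs) ≡ cs
children-sweep xs []       = refl
children-sweep xs (c ∷ cs) = cong (c ∷_) (children-sweep xs cs)

data Run {n} : Fin n → List (Fin n) → Fin n → Set where
  single : ∀ {c} → Run c (c ∷ []) c
  _∷_    : ∀ {c c₁ c' cs} → toℕ c₁ ≡ suc (toℕ c) → Run c₁ (c₁ ∷ cs) c' → Run c (c ∷ c₁ ∷ cs) c'

run-suc : ∀ {n} {c c' : Fin n} {cs} → Run c cs c' → Run (fs c) (map fs cs) (fs c')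
run-suc single  = single
run-suc (p ∷ r) = cong suc p ∷ run-suc r

run-tail : ∀ {n} {c c₁ c' : Fin n} {cs} → Run c (c ∷ c₁ ∷ cs) c' → Run c₁ (c₁ ∷ cs) c'
run-tail (_ ∷ r) = r

allFin-run : ∀ e → Run fz (allFin (suc e)) (fromℕ e)
allFin-run zero    = single
allFin-run (suc e) =
  refl ∷ subst (λ cs → Run (fs fz) cs (fs (fromℕ e))) (map-tabulate {n = suc e} (λ i → i) fs) (run-suc (allFin-run e))

allFin-∷ʳ : ∀ e → tabulate inject₁ ∷ʳ fromℕ e ≡ allFin (suc e)
allFin-∷ʳ zero    = refl
allFin-∷ʳ (suc e) = cong (fz ∷_) (begin
  tabulate (fs ∘ inject₁) ∷ʳ fs (fromℕ e)    ≡⟨ cong (_∷ʳ fs (fromℕ e)) (sym (map-tabulate inject₁ fs)) ⟩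
  map fs (tabulate inject₁) ∷ʳ fs (fromℕ e)  ≡⟨ sym (map-++ fs (tabulate inject₁) _) ⟩
  map fs (tabulate inject₁ ∷ʳ fromℕ e)       ≡⟨ cong (map fs) (allFin-∷ʳ e) ⟩
  map fs (allFin (suc e))                    ≡⟨ map-tabulate (λ i → i) fs ⟩
  tabulate fs                                ∎)
  where open ≡-Reasoning

appendSweep : ∀ {e k} {xs : List (Addr e)} {x ys c c' cs} → Run c (c ∷ cs) c' →
              All (λ _ → Walk (TreeAdj k) (leftLeaf k) (rightLeaf e k) xs) cs →
              Walk (TreeAdj (suc k)) x (rightLeaf e k ∷ʳ c) ys →
              Walk (TreeAdj (suc k)) x (rightLeaf e k ∷ʳ c') (ys ++ glue (sweep xs cs))
appendSweep {ys = ys} single [] w = subst (Walk _ _ _) (sym (++-identityʳ ys)) w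
appendSweep {k = k} {xs} {ys = ys} {cs = c₁ ∷ cs} (p ∷ r) (w₁ ∷ ws) w =
  subst (Walk _ _ _) (++-assoc ys (inSubtree c₁ xs) (glue (sweep xs cs)))
    (appendSweep r ws (join w (junction k p) (walkInSubtree c₁ w₁)))

prependSweep : ∀ {e k} {xs : List (Addr e)} {y ys c c'} cs → Run c (cs ∷ʳ c') c' →
               All (λ _ → Walk (TreeAdj k) (leftLeaf k) (rightLeaf e k) xs) cs →
               Walk (TreeAdj (suc k)) (leftLeaf k ∷ʳ c') y ys →
               Walk (TreeAdj (suc k)) (leftLeaf k ∷ʳ c) y (glue (sweep xs cs) ++ ys)
prependSweep [] single [] w = w
prependSweep {k = k} {xs} {ys = ys} (c ∷ []) (p ∷ single) (w₁ ∷ []) w =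
  subst (Walk _ _ _) (sym (++-assoc (inSubtree c xs) [] ys)) (join (walkInSubtree c w₁) (junction k p) w)
prependSweep {k = k} {xs} {ys = ys} (c ∷ c₁ ∷ cs) (p ∷ r) (w₁ ∷ ws) w =
  subst (Walk _ _ _) (sym (++-assoc (inSubtree c xs) _ ys))
    (join (walkInSubtree c w₁) (junction k p) (prependSweep (c₁ ∷ cs) r ws w))

-- The three Hamiltonian paths of the tree of degree suc e and height k.
-- rootToRight: the root, subtree 0 from its root to its rightmost leaf,
--   then the subtrees 1, …, e each from leftmost to rightmost leaf.
-- leftToRoot: the subtrees 0, …, e - 1 each from leftmost to rightmost leaf,
--   subtree e from its leftmost leaf to its root, then the root.
-- leftToRight: subtree 0 from its leftmost leaf to its root, the root,
--   subtree 1 from its root to its rightmost leaf, then the subtrees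
--   2, …, e each from leftmost to rightmost leaf.
mutual
  rootToRight : ∀ e → ℕ → List (Addr e)
  rootToRight e zero    = [] ∷ []
  rootToRight e (suc k) = [] ∷ glue ((fz , rootToRight e k) ∷ sweep (leftToRight e k) (tabulate fs))

  leftToRoot : ∀ e → ℕ → List (Addr e)
  leftToRoot e zero    = [] ∷ []
  leftToRoot e (suc k) =
    glue (sweep (leftToRight e k) (tabulate inject₁)) ++ inSubtree (fromℕ e) (leftToRoot e k) ++ [] ∷ []

  -- For degree 1 (e = 0) this is not a walk, but it still enumerates the
  -- tree; for that degree it only occurs in sweeps over no children.
  leftToRight : ∀ e → ℕ → List (Addr e)
  leftToRight e       zero    = [] ∷ []
  leftToRight zero    (suc k) = inSubtree fz (leftToRoot zero k) ++ [] ∷ []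
  leftToRight (suc e) (suc k) =
    inSubtree fz (leftToRoot (suc e) k) ++
    [] ∷ glue ((fs fz , rootToRight (suc e) k) ∷ sweep (leftToRight (suc e) k) (tabulate (fs ∘ fs)))

mutual
  rootToRight-walk : ∀ e k → Walk (TreeAdj k) [] (rightLeaf e k) (rootToRight e k)
  rootToRight-walk e zero    = done []
  rootToRight-walk e (suc k) =
    subst (λ y → Walk (TreeAdj (suc k)) [] y (rootToRight e (suc k))) (replicate-∷ʳ k (fromℕ e))
      (inj₁ (toChild [] fz) ◅ appendSweep (allFin-run e) (crossings e k fs) (walkInSubtree fz (rootToRight-walk e k)))

  leftToRoot-walk : ∀ e k → Walk (TreeAdj k) (leftLeaf k) [] (leftToRoot e k)
  leftToRoot-walk e zero    = done []
  leftToRoot-walk e (suc k) =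
    subst (λ x → Walk (TreeAdj (suc k)) x [] (leftToRoot e (suc k))) (replicate-∷ʳ k fz)
      (prependSweep (tabulate inject₁) (subst (λ cs → Run fz cs (fromℕ e)) (sym (allFin-∷ʳ e)) (allFin-run e))
        (crossings e k inject₁)
        (join (walkInSubtree (fromℕ e) (leftToRoot-walk e k)) (inj₂ (toChild [] (fromℕ e))) (done [])))

  leftToRight-walk : ∀ e k → Walk (TreeAdj k) (leftLeaf k) (rightLeaf (suc e) k) (leftToRight (suc e) k)
  leftToRight-walk e zero    = done []
  leftToRight-walk e (suc k) =
    subst₂ (λ x y → Walk (TreeAdj (suc k)) x y (leftToRight (suc e) (suc k)))
      (replicate-∷ʳ k fz) (replicate-∷ʳ k (fromℕ (suc e)))
      (join (walkInSubtree fz (leftToRoot-walk (suc e) k)) (inj₂ (toChild [] fz))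
        (inj₁ (toChild [] (fs fz)) ◅
          appendSweep (run-tail (allFin-run (suc e))) (All.universal (λ _ → leftToRight-walk e k) _)
            (walkInSubtree (fs fz) (rootToRight-walk (suc e) k))))

  crossings : ∀ e k (f : Fin e → Fin (suc e)) →
              All (λ _ → Walk (TreeAdj k) (leftLeaf k) (rightLeaf e k) (leftToRight e k)) (tabulate f)
  crossings zero    k f = []
  crossings (suc e) k f = All.universal (λ _ → leftToRight-walk e k) _

record Enumerates {e} (k : ℕ) (xs : List (Addr e)) : Set where
  field
    unique   : Unique xs
    bounded  : All (λ a → length a ≤ k) xs
    complete : ∀ a → length a ≤ k → a ∈ xs
open Enumerates

enumerates-↭ : ∀ {e k} {xs ys : List (Addr e)} → xs ↭ ys → Enumerates k xs → Enumerates k ys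
enumerates-↭ {e} σ en = record
  { unique   = SetoidPermutation.Unique-resp-↭ (setoid (Addr e)) (↭⇒↭ₛ σ) (unique en)
  ; bounded  = All-resp-↭ σ (bounded en)
  ; complete = λ a l → ∈-resp-↭ σ (complete en a l)
  }

enumerates-root : ∀ {e} → Enumerates {e} 0 ([] ∷ [])
enumerates-root = record
  { unique   = [] ∷ []
  ; bounded  = z≤n ∷ []
  ; complete = λ { [] _ → here refl ; (_ ∷ _) () }
  }

glue-∈⁺ : ∀ {e} {bs : List (Block e)} {c xs q} → (c , xs) ∈ bs → q ∈ xs → q ∷ʳ c ∈ glue bs
glue-∈⁺ (here refl) q∈ = ∈-++⁺ˡ (∈-map⁺ _ q∈)
glue-∈⁺ {bs = (c , xs) ∷ _} (there b∈) q∈ = ∈-++⁺ʳ (inSubtree c xs) (glue-∈⁺ b∈ q∈)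

glue-∈⁻ : ∀ {e} (bs : List (Block e)) {a} → a ∈ glue bs → ∃₂ λ q c → c ∈ map proj₁ bs × a ≡ q ∷ʳ c
glue-∈⁻ ((c , xs) ∷ bs) a∈ with ∈-++⁻ (inSubtree c xs) a∈
... | inj₁ a∈xs with ∈-map⁻ (_∷ʳ c) a∈xs
...   | q , _ , a≡ = q , c , here refl , a≡
glue-∈⁻ ((c , xs) ∷ bs) a∈ | inj₂ a∈bs with glue-∈⁻ bs a∈bs
...   | q , c' , c'∈ , a≡ = q , c' , there c'∈ , a≡

[]≢∷ʳ : ∀ {A : Set} (q : List A) x → [] ≢ q ∷ʳ x
[]≢∷ʳ []      x ()
[]≢∷ʳ (_ ∷ _) x ()

glue-unique : ∀ {e} (bs : List (Block e)) → Unique (map proj₁ bs) → All (Unique ∘ proj₂) bs → Unique (glue bs)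
glue-unique []              _         _           = []
glue-unique ((c , xs) ∷ bs) (c∉ ∷ u) (uxs ∷ us) =
  Unique.++⁺ (Unique.map⁺ (λ {q} {q'} eq → proj₁ (∷ʳ-injective q q' eq)) uxs) (glue-unique bs u us) disjoint
  where
  disjoint : Disjoint (inSubtree c xs) (glue bs)
  disjoint (a∈xs , a∈bs) with ∈-map⁻ (_∷ʳ c) a∈xs | glue-∈⁻ bs a∈bs
  ... | q , _ , refl | q' , c' , c'∈ , eq = All.lookup c∉ c'∈ (proj₂ (∷ʳ-injective q q' eq))

inSubtree-bounded : ∀ {e k} c {xs : List (Addr e)} →
                    All (λ a → length a ≤ k) xs → All (λ a → length a ≤ suc k) (inSubtree c xs)
inSubtree-bounded c = All.map⁺ ∘ All.map (λ {q} l → subst (_≤ _) (sym (length-∷ʳ q c)) (s≤s l))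

glue-bounded : ∀ {e k} (bs : List (Block e)) →
               All (λ b → All (λ a → length a ≤ k) (proj₂ b)) bs → All (λ a → length a ≤ suc k) (glue bs)
glue-bounded []              []       = []
glue-bounded ((c , xs) ∷ bs) (l ∷ ls) = All.++⁺ (inSubtree-bounded c l) (glue-bounded bs ls)

enumerates-tree : ∀ {e k} (bs : List (Block e)) → map proj₁ bs ≡ allFin (suc e) →
                  All (λ b → Enumerates k (proj₂ b)) bs → Enumerates (suc k) ([] ∷ glue bs)
enumerates-tree {e} {k} bs children ens = record
  { unique   = All.tabulate (λ {a} a∈ []≡a → root∉glue a∈ []≡a)
               ∷ glue-unique bs (subst Unique (sym children) (Unique.allFin⁺ (suc e))) (All.map unique ens)
  ; bounded  = z≤n ∷ glue-bounded bs (All.map bounded ens)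
  ; complete = λ a l → complete′ a (initLast a) l
  }
  where
  root∉glue : ∀ {a} → a ∈ glue bs → [] ≢ a
  root∉glue a∈ with glue-∈⁻ bs a∈
  ... | q , c , _ , refl = []≢∷ʳ q c
  complete′ : ∀ a → InitLast a → length a ≤ suc k → a ∈ [] ∷ glue bs
  complete′ .[] [] _ = here refl
  complete′ .(q ∷ʳ c) (q ∷ʳ′ c) l with ∈-map⁻ proj₁ (subst (c ∈_) (sym children) (∈-allFin c))
  ... | (_ , xs) , b∈ , refl =
    there (glue-∈⁺ b∈ (complete (All.lookup ens b∈) q (s≤s⁻¹ (subst (_≤ suc k) (length-∷ʳ q c) l))))

sweep-all : ∀ {e} {P : List (Addr e) → Set} {xs} → P xs → ∀ cs → All (P ∘ proj₂) (sweep xs cs)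
sweep-all p cs = All.map⁺ (All.universal (λ _ → p) cs)

root-to-end : ∀ {e} (bs : List (Block e)) c xs →
              [] ∷ glue (bs ∷ʳ (c , xs)) ↭ glue bs ++ inSubtree c xs ++ [] ∷ []
root-to-end bs c xs = begin
  [] ∷ glue (bs ∷ʳ (c , xs))                    ≡⟨ cong ([] ∷_) (glue-++ bs _) ⟩
  [] ∷ (glue bs ++ (inSubtree c xs ++ []))      ≡⟨ cong ([] ∷_) (sym (++-assoc (glue bs) _ [])) ⟩
  [] ∷ ((glue bs ++ inSubtree c xs) ++ [])      ↭⟨ shift [] (glue bs ++ inSubtree c xs) [] ⟨
  (glue bs ++ inSubtree c xs) ++ [] ∷ []        ≡⟨ ++-assoc (glue bs) _ _ ⟩
  glue bs ++ inSubtree c xs ++ [] ∷ []          ∎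
  where open PermutationReasoning

mutual
  rootToRight-enum : ∀ e k → Enumerates k (rootToRight e k)
  rootToRight-enum e zero    = enumerates-root
  rootToRight-enum e (suc k) =
    enumerates-tree _ (cong (fz ∷_) (children-sweep _ (tabulate fs)))
      (rootToRight-enum e k ∷ sweep-all (leftToRight-enum e k) _)

  leftToRoot-enum : ∀ e k → Enumerates k (leftToRoot e k)
  leftToRoot-enum e zero    = enumerates-root
  leftToRoot-enum e (suc k) =
    enumerates-↭ (root-to-end (sweep (leftToRight e k) (tabulate inject₁)) (fromℕ e) (leftToRoot e k))
      (enumerates-tree _ children (All.++⁺ (sweep-all (leftToRight-enum e k) _) (leftToRoot-enum e k ∷ [])))
    where
    children : map proj₁ (sweep (leftToRight e k) (tabulate inject₁) ∷ʳ (fromℕ e , leftToRoot e k)) ≡ allFin (suc e)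
    children = trans (map-++ proj₁ (sweep _ (tabulate inject₁)) _)
                     (trans (cong (_∷ʳ fromℕ e) (children-sweep _ _)) (allFin-∷ʳ e))

  leftToRight-enum : ∀ e k → Enumerates k (leftToRight e k)
  leftToRight-enum e       zero    = enumerates-root
  leftToRight-enum zero    (suc k) =
    enumerates-↭ (↭-sym (shift [] (inSubtree fz (leftToRoot zero k)) []))
      (enumerates-tree ((fz , leftToRoot zero k) ∷ []) refl (leftToRoot-enum zero k ∷ []))
  leftToRight-enum (suc e) (suc k) =
    enumerates-↭ (↭-sym (shift [] (inSubtree fz (leftToRoot (suc e) k)) _))
      (enumerates-tree _ (cong (λ cs → fz ∷ fs fz ∷ cs) (children-sweep _ _))
        (leftToRoot-enum (suc e) k ∷ rootToRight-enum (suc e) k ∷ sweep-all (leftToRight-enum (suc e) k) _))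

-- Every edge of a single tree is an edge of either copy in the double tree
-- (leaves have positive depth as h ≥ 1).
treeEdge : ∀ {e h} s {a b : Addr e} → 1 ≤ h → TreeStep h a b → Edge (suc e) h s a s b
treeEdge s _       (toChild p c)                              = tree s p c
treeEdge s (s≤s _) (toNextLeaf {[]} () _ _)
treeEdge s (s≤s _) (toNextLeaf {_ ∷ _} {[]} _ () _)
treeEdge s _       (toNextLeaf {c ∷ r} {c' ∷ r'} la lb next) = leafE1 s c c' r r' la lb next

embed : ∀ {e h} (s : Side) {xs : List (Addr e)} → All (λ a → length a ≤ h) xs → List (DTVertex (suc e) h)
embed s ps = map (s ,_) (All.toList ps)

start-bound : ∀ {A : Set} {R} {P : A → Set} {x y xs} → Walk R x y xs → All P xs → P x
start-bound (done _) (p ∷ _) = p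
start-bound (_ ◅ _)  (p ∷ _) = p

embed-walk : ∀ {e h} s → 1 ≤ h → ∀ {x y : Addr e} {xs} → Walk (TreeAdj h) x y xs →
             (ps : All (λ a → length a ≤ h) xs) → ∀ {p q} →
             Walk (Adj (suc e) h) (s , x , p) (s , y , q) (embed s ps)
embed-walk s h≥1 (done _) (p′ ∷ []) {p} {q} rewrite ≤-irrelevant p p′ | ≤-irrelevant q p′ = done _
embed-walk s h≥1 (r ◅ w)  (p′ ∷ ps) {p} rewrite ≤-irrelevant p p′ =
  edge r ◅ embed-walk s h≥1 w ps {start-bound w ps}
  where
  edge : ∀ {a b} → TreeAdj _ a b → Edge _ _ s a s b ⊎ Edge _ _ s b s a
  edge (inj₁ st) = inj₁ (treeEdge s h≥1 st)
  edge (inj₂ st) = inj₂ (treeEdge s h≥1 st)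

toList-addresses : ∀ {A : Set} {P : A → Set} {xs} (ps : All P xs) → map proj₁ (All.toList ps) ≡ xs
toList-addresses []       = refl
toList-addresses (_ ∷ ps) = cong (_ ∷_) (toList-addresses ps)

embed-unique : ∀ {e h} s {xs : List (Addr e)} (ps : All (λ a → length a ≤ h) xs) → Unique xs → Unique (embed s ps)
embed-unique s ps u =
  Unique.map⁺ (λ { refl → refl }) (Unique.map⁻ (subst Unique (sym (toList-addresses ps)) u))

embed-∈ : ∀ {e h} s {xs : List (Addr e)} {a} → a ∈ xs → (ps : All (λ a → length a ≤ h) xs) → ∀ p →
          (s , a , p) ∈ embed s ps
embed-∈ s (here refl) (p′ ∷ _)  p = here (cong (λ z → s , _ , z) (≤-irrelevant p p′))
embed-∈ s (there a∈)  (_ ∷ ps) p = there (embed-∈ s a∈ ps p)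

sides-disjoint : ∀ {e h} {xs ys : List (Addr e)}
                 (ps : All (λ a → length a ≤ h) xs) (qs : All (λ a → length a ≤ h) ys) →
                 Disjoint (embed upper ps) (embed lower qs)
sides-disjoint ps qs (v∈ , v∈′) with ∈-map⁻ (upper ,_) v∈ | ∈-map⁻ (lower ,_) v∈′
... | _ , _ , refl | _ , _ , ()

-- The E2 edge from the rightmost upper leaf to the leftmost lower leaf:
-- u_1^1 v_1^1 for degree 1, and u_d^l v_1^1 otherwise.
crossEdge : ∀ e h → Edge (suc e) (suc h) upper (rightLeaf e (suc h)) lower (leftLeaf (suc h))
crossEdge zero    h = cross1 fz fz _ _ (cong suc (length-replicate h)) (cong suc (length-replicate h)) refl z≤n
crossEdge (suc e) h =
  cross3 (fromℕ (suc e)) fz _ _ (cong suc (length-replicate h)) (cong suc (length-replicate h))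
    (trans (sym (m+n∸n≡m _ 1)) (cong (_∸ 1) (val-rightLeaf (suc e) h))) (val-leftLeaf h) (s≤s z≤n)

hamiltonian : ∀ {d h x y} {P : List (DTVertex d h)} →
              Walk (Adj d h) x y P → Unique P → (∀ v → v ∈ P) → HamiltonianPath d h x y
hamiltonian w u c = _ , walk-linked w , u , c , walk-head w , walk-last w

lemma5 : ∀ (d h : ℕ) → 1 ≤ d → 1 ≤ h → HamiltonianPath d h rootU rootL
lemma5 (suc e) (suc h) _ _ = hamiltonian walk noRepeats covers
  where
  upperEnum : Enumerates (suc h) (rootToRight e (suc h))
  upperEnum = rootToRight-enum e (suc h)
  lowerEnum : Enumerates (suc h) (leftToRoot e (suc h))
  lowerEnum = leftToRoot-enum e (suc h)
  upperBounds : All (λ a → length a ≤ suc h) (rootToRight e (suc h))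
  upperBounds = bounded upperEnum
  lowerBounds : All (λ a → length a ≤ suc h) (leftToRoot e (suc h))
  lowerBounds = bounded lowerEnum
  upperPart lowerPart : List (DTVertex (suc e) (suc h))
  upperPart = embed upper upperBounds
  lowerPart = embed lower lowerBounds
  leafBound : ∀ c → length (replicate (suc h) c) ≤ suc h
  leafBound c = ≤-reflexive (length-replicate (suc h))
  walk : Walk (Adj (suc e) (suc h)) rootU rootL (upperPart ++ lowerPart)
  walk = join (embed-walk upper (s≤s z≤n) (rootToRight-walk e (suc h)) upperBounds {q = leafBound (fromℕ e)})
              (inj₁ (crossEdge e h))
              (embed-walk lower (s≤s z≤n) (leftToRoot-walk e (suc h)) lowerBounds {p = leafBound fz})
  noRepeats : Unique (upperPart ++ lowerPart)
  noRepeats = Unique.++⁺ (embed-unique upper upperBounds (unique upperEnum))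
                         (embed-unique lower lowerBounds (unique lowerEnum))
                         (sides-disjoint upperBounds lowerBounds)
  covers : ∀ v → v ∈ upperPart ++ lowerPart
  covers (upper , a , p) = ∈-++⁺ˡ (embed-∈ upper (complete upperEnum a p) upperBounds p)
  covers (lower , a , p) = ∈-++⁺ʳ upperPart (embed-∈ lower (complete lowerEnum a p) lowerBounds p)
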